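{- $2\mathrm{D}\neq 2\mathrm{DCT}$, $2\mathrm{U}\neq 2\mathrm{UCT}$, and $2\mathrm{N}\neq 2\mathrm{NCT}$.
   Context: A promise problem over a finite alphabet $\Sigma$ is a pair $(A,R)$ with $A,R\subseteq\Sigma^*$ and $A\cap R=\varnothing$. We consider families $\mathcal{L}=\{(L_n^{(+)},L_n^{(-)})\}_{n\in\mathbb{N}}$ of promise problems over a common alphabet $\Sigma$. A two-way nondeterministic finite automaton (2nfa) has a finite set $Q$ of inner states, an initial state, and disjoint sets of accepting and rejecting states; it reads the input $x$ surrounded by endmarkers $\rhd,\lhd$ on a read-only tape with a two-way head. A 2nfa $M$ solves $(A,R)$ if every $x\in A$ has an accepting computation path and, for every $x\in R$, all (halting) computation paths of $M$ on $x$ are rejecting. A 2dfa is a deterministic 2nfa; a 2nfa is unambiguous if it has at most one accepting computation path on each input in $A\cup R$. A counter is a stack whose alphabet is $\{1,\bot\}$ with $\bot$ a fixed bottom marker (so it stores a natural number and the machine can test whether it is zero, increment or decrement it). A 2dcta/2ucta/2ncta with $k$ counters is a 2dfa/unambiguous 2nfa/2nfa additionally equipped with $k$ counters. The state complexity of such a machine is $|Q|$; a family $\{M_n\}_{n\in\mathbb{N}}$ is of polynomial size if the state complexity of $M_n$ is at most $p(n)$ for some polynomial $p$ and all $n$. $2\mathrm{D}$, $2\mathrm{U}$, $2\mathrm{N}$ denote the classes of families $\mathcal{L}$ for which there is a polynomial-size family $\{M_n\}$ of 2dfa's, unambiguous 2nfa's, 2nfa's respectively such that $M_n$ solves $(L_n^{(+)},L_n^{(-)})$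 for every $n$. $2\mathrm{DCT}$, $2\mathrm{UCT}$, $2\mathrm{NCT}$ are defined in the same way using machines with one counter. -}

module Defs where

open import Data.Nat using (ℕ; zero; suc; _+_; _*_; _≤_)
open import Data.Fin using (Fin)
open import Data.List using (List; []; _∷_; length)
open import Data.Vec using (Vec; []; _∷_; map)
open import Data.Bool using (Bool; true; false)
open import Data.Maybe using (Maybe; just; nothing)
open import Data.Product using (Σ; ∃; _×_; _,_; proj₁)
open import Data.Sum using (_⊎_)
open import Data.Unit using (⊤)
open import Data.Empty using (⊥)
open import Relation.Binary.PropositionalEquality using (_≡_)
open import Relation.Nullary using (¬_)

record PromiseProblem (s : ℕ) : Set₁ where
  field
    Acc      : List (Fin s) → Set
    Rej      : List (Fin s) → Set
    disjoint : ∀ x → Acc x → Rej x → ⊥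
open PromiseProblem public

Family : ℕ → Set₁
Family s = ℕ → PromiseProblem s

data Tape (s : ℕ) : Set where
  ⊳   : Tape s
  sym : Fin s → Tape s
  ⊲   : Tape s

-- Tape content of ⊳ x ⊲ at cell i (cell 0 = ⊳, cell |x|+1 = ⊲).
tapeAt : ∀ {s} → List (Fin s) → ℕ → Tape s
tapeAt x zero = ⊳
tapeAt [] (suc i) = ⊲
tapeAt (a ∷ x) (suc zero) = sym a
tapeAt (a ∷ x) (suc (suc i)) = tapeAt x (suc i)

data Move : Set where
  left stay right : Move

move : Move → ℕ → Maybe ℕ
move left zero = nothing
move left (suc i) = just i
move stay i = just i
move right i = just (suc i)

data Op : Set where
  inc dec nop : Op

applyOp : Op → ℕ → Maybe ℕ
applyOp inc c = just (suc c)
applyOp dec zero = nothing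
applyOp dec (suc c) = just c
applyOp nop c = just c

applyOps : ∀ {k} → Vec Op k → Vec ℕ k → Maybe (Vec ℕ k)
applyOps [] [] = just []
applyOps (o ∷ os) (c ∷ cs) with applyOp o c | applyOps os cs
... | just c' | just cs' = just (c' ∷ cs')
... | _ | _ = nothing

isZero : ℕ → Bool
isZero zero = true
isZero (suc _) = false

-- Two-way nondeterministic finite automata with k counters
-- (k = 0: plain 2nfa).  States are Fin q, so the state complexity is q.

data Status : Set where
  accepting rejecting inner : Status

Transition : ℕ → ℕ → Set
Transition q k = Fin q × Move × Vec Op k

record Machine (s k q : ℕ) : Set where
  field
    init   : Fin q
    status : Fin q → Status
    -- δ p a z t : transition t is allowed in state p reading tape symbol a
    -- when the zero-tests of the counters give z.
    δ      : Fin q → Tape s → Vec Bool k → Transition q k → Bool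
open Machine public

Config : ℕ → ℕ → Set
Config q k = Fin q × ℕ × Vec ℕ k     -- state, head position, counter values

initConfig : ∀ {s k q} → Machine s k q → Config q k
initConfig {k = k} M = init M , 0 , Data.Vec.replicate k 0

data Step {s k q} (M : Machine s k q) (x : List (Fin s)) :
          Config q k → Config q k → Set where
  step : ∀ {p i cs p' d ops i' cs'} →
         status M p ≡ inner →
         δ M p (tapeAt x i) (map isZero cs) (p' , d , ops) ≡ true →
         move d i ≡ just i' →
         i' ≤ suc (length x) →
         applyOps ops cs ≡ just cs' →
         Step M x (p , i , cs) (p' , i' , cs')

data Chain {s k q} (M : Machine s k q) (x : List (Fin s)) :
           Config q k → List (Config q k) → Set where
  []  : ∀ {c} → Chain M x c []
  _∷_ : ∀ {c c' ρ} → Step M x c c' → Chain M x c' ρ → Chain M x c (c' ∷ ρ)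

final : ∀ {q k} → Config q k → List (Config q k) → Config q k
final c [] = c
final c (c' ∷ ρ) = final c' ρ

AccPath : ∀ {s k q} → Machine s k q → List (Fin s) → List (Config q k) → Set
AccPath M x ρ =
  Chain M x (initConfig M) ρ × status M (proj₁ (final (initConfig M) ρ)) ≡ accepting

Solves : ∀ {s k q} → Machine s k q → PromiseProblem s → Set
Solves M P =
  (∀ x → Acc P x → ∃ λ ρ → AccPath M x ρ) ×
  (∀ x → Rej P x → ∀ ρ → ¬ AccPath M x ρ)

Deterministic : ∀ {s k q} → Machine s k q → Set
Deterministic M = ∀ p a z t t' → δ M p a z t ≡ true → δ M p a z t' ≡ true → t ≡ t'

Unambiguous : ∀ {s k q} → Machine s k q → PromiseProblem s → Set
Unambiguous M P = ∀ x → Acc P x ⊎ Rej P x →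
  ∀ ρ ρ' → AccPath M x ρ → AccPath M x ρ' → ρ ≡ ρ'

-- Polynomials with natural coefficients (list of coefficients, constant first).

evalPoly : List ℕ → ℕ → ℕ
evalPoly [] n = 0
evalPoly (a ∷ as) n = a + n * evalPoly as n

data Mode : Set where
  det unamb nondet : Mode

ModeCond : ∀ {s k q} → Mode → Machine s k q → PromiseProblem s → Set
ModeCond det M P = Deterministic M
ModeCond unamb M P = Unambiguous M P
ModeCond nondet M P = ⊤

Class : Mode → ℕ → (s : ℕ) → Family s → Set
Class m k s L =
  Σ (List ℕ) λ poly → Σ (ℕ → ℕ) λ q → Σ ((n : ℕ) → Machine s k (q n)) λ M →
    (∀ n → q n ≤ evalPoly poly n) ×
    (∀ n → Solves (M n) (L n) × ModeCond m (M n) (L n))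

2D 2U 2N 2DCT 2UCT 2NCT : (s : ℕ) → Family s → Set
2D   = Class det 0
2U   = Class unamb 0
2N   = Class nondet 0
2DCT = Class det 1
2UCT = Class unamb 1
2NCT = Class nondet 1

_≐_ : ((s : ℕ) → Family s → Set) → ((s : ℕ) → Family s → Set) → Set₁
C ≐ C' = ∀ s (L : Family s) → (C s L → C' s L) × (C' s L → C s L)

-- The promise problem "a^m b^m versus a^j b^m with j ≠ m" (the same for every n) is solved by a fixed
-- deterministic one-counter automaton with four states, which counts the a's up and the b's down.
-- No 2nfa solves it at all.  A 2nfa with q states accepting a^N b^N, N = (2q+1)^(2q), has a loop-free
-- accepting run; the crossing sequence of such a run at any boundary is a repetition-free list of
-- (direction, state) pairs, of which there are fewer than N + 1.  Hence two boundaries inside the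
-- a-block carry the same crossing sequence, and cutting out the cells between them yields an accepting
-- run on some a^j b^N with j < N, a word the 2nfa must reject.

module Submission where

open import Data.Bool using (Bool; true; false)
open import Data.Empty using (⊥-elim)
open import Data.Fin as Fin using (Fin; zero; suc; toℕ; combine)
import Data.Fin.Properties as Finₚ
open import Data.List using (List; []; _∷_; length; _++_; replicate; map; lookup)
open import Data.List.Properties using (∷-injective; length-++; length-++-≤ˡ; length-replicate; map-injective)
open import Data.List.Membership.Propositional using (_∈_; _∉_)
open import Data.List.Membership.Propositional.Properties using (∈-lookup)
open import Data.List.Relation.Binary.Sublist.Propositional using (_⊆_; []; _∷_; _∷ʳ_)
open import Data.List.Relation.Binary.Sublist.Propositional.Properties using (All-resp-⊆)
import Data.List.Relation.Unary.All as All
open import Data.List.Relation.Unary.All.Properties using (¬Any⇒All¬; All¬⇒¬Any)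
open import Data.List.Relation.Unary.Any using (here; there; any?)
open import Data.List.Relation.Unary.AllPairs using ([]; _∷_)
open import Data.List.Relation.Unary.Unique.Propositional using (Unique)
import Data.List.Relation.Unary.Unique.Propositional.Properties as Unique
open import Data.Maybe using (just)
open import Data.Nat as ℕ using (ℕ; zero; suc; _+_; _*_; _∸_; _^_; _≤_; _<_; z≤n; s≤s; _≤?_)
open import Data.Nat.Properties
open import Data.Product using (Σ; ∃; ∃₂; _×_; _,_; -,_; proj₁; proj₂; uncurry)
import Data.Product.Properties as Product
open import Data.Unit using (tt)
open import Data.Vec using ([]; _∷_)
import Data.Vec.Properties as Vec
open import Function using (_∘_)
open import Relation.Binary.Construct.Closure.ReflexiveTransitive using (Star; ε; _◅_)
open import Relation.Binary.Definitions using (DecidableEquality)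
open import Relation.Binary.PropositionalEquality as ≡
  using (_≡_; _≢_; refl; cong; cong₂; subst; subst₂; module ≡-Reasoning)
open import Relation.Nullary using (¬_; yes; no; does)
open import Relation.Nullary.Decidable using (dec-true; _×-dec_)

open import Defs

data AccRun {s k q} (M : Machine s k q) (x : List (Fin s)) : Config q k → Set where
  halt : ∀ {c} → status M (proj₁ c) ≡ accepting → AccRun M x c
  _▸_  : ∀ {c c'} → Step M x c c' → AccRun M x c' → AccRun M x c

infixr 5 _▸_

module _ {s k q} {M : Machine s k q} {x : List (Fin s)} where

  chain⇒accRun : ∀ {c ρ} → Chain M x c ρ → status M (proj₁ (final c ρ)) ≡ accepting → AccRun M x c
  chain⇒accRun []        accepted = halt accepted
  chain⇒accRun (st ∷ ch) accepted = st ▸ chain⇒accRun ch accepted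

  accRun⇒chain : ∀ {c} → AccRun M x c →
                 ∃ λ ρ → Chain M x c ρ × status M (proj₁ (final c ρ)) ≡ accepting
  accRun⇒chain (halt accepted) = [] , [] , accepted
  accRun⇒chain (st ▸ r) with ρ , ch , accepted ← accRun⇒chain r = -, st ∷ ch , accepted

  _▸▸_ : ∀ {c c'} → Star (Step M x) c c' → AccRun M x c' → AccRun M x c
  ε          ▸▸ r = r
  (st ◅ sts) ▸▸ r = st ▸ (sts ▸▸ r)

  accepting-halts : ∀ {c c'} → status M (proj₁ c) ≡ accepting → ¬ Step M x c c'
  accepting-halts accepted (step running _ _ _ _) with ≡.trans (≡.sym accepted) running
  ... | ()

  rejecting-rejects : ∀ {c} → status M (proj₁ c) ≡ rejecting → ¬ AccRun M x c
  rejecting-rejects rejected (halt accepted) with ≡.trans (≡.sym accepted) rejected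
  ... | ()
  rejecting-rejects rejected (step running _ _ _ _ ▸ _) with ≡.trans (≡.sym running) rejected
  ... | ()

  step-deterministic : ∀ {c c₁ c₂} → Deterministic M → Step M x c c₁ → Step M x c c₂ → c₁ ≡ c₂
  step-deterministic isDet (step _ fires₁ moved₁ _ counters₁) (step _ fires₂ moved₂ _ counters₂)
    with refl ← isDet _ _ _ _ _ fires₁ fires₂
    with refl ← ≡.trans (≡.sym moved₁) moved₂
    with refl ← ≡.trans (≡.sym counters₁) counters₂ = refl

  chain-deterministic : Deterministic M → ∀ {c ρ ρ'} → Chain M x c ρ → Chain M x c ρ' →
                        status M (proj₁ (final c ρ)) ≡ accepting →
                        status M (proj₁ (final c ρ')) ≡ accepting → ρ ≡ ρ'
  chain-deterministic isDet []        []          _        _         = refl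
  chain-deterministic isDet []        (st ∷ _)    accepted _         = ⊥-elim (accepting-halts accepted st)
  chain-deterministic isDet (st ∷ _)  []          _        accepted' = ⊥-elim (accepting-halts accepted' st)
  chain-deterministic isDet (st ∷ ch) (st' ∷ ch') accepted accepted'
    with refl ← step-deterministic isDet st st' =
    cong (_ ∷_) (chain-deterministic isDet ch ch' accepted accepted')

  accRun-after : Deterministic M → ∀ {c c'} → Star (Step M x) c c' → AccRun M x c → AccRun M x c'
  accRun-after isDet ε          r                = r
  accRun-after isDet (st ◅ _)   (halt accepted)  = ⊥-elim (accepting-halts accepted st)
  accRun-after isDet (st ◅ sts) (st' ▸ r)
    with refl ← step-deterministic isDet st st' = accRun-after isDet sts r

Deterministic⇒Unambiguous : ∀ {s k q} {M : Machine s k q} → Deterministic M → ∀ P → Unambiguous M P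
Deterministic⇒Unambiguous isDet _ _ _ _ _ (ch , accepted) (ch' , accepted') =
  chain-deterministic isDet ch ch' accepted accepted'

pattern 𝑎 = zero
pattern 𝑏 = suc zero

word : ℕ → ℕ → List (Fin 2)
word j m = replicate j 𝑎 ++ replicate m 𝑏

replicate-+-++ : ∀ {A : Set} m n {a : A} w → replicate (m + n) a ++ w ≡ replicate m a ++ replicate n a ++ w
replicate-+-++ zero    n w = refl
replicate-+-++ (suc m) n w = cong (_ ∷_) (replicate-+-++ m n w)

word-injective : ∀ j m j' m' → word j m ≡ word j' m' → j ≡ j' × m ≡ m'
word-injective zero    m zero     m' e =
  refl , ≡.trans (≡.sym (length-replicate m)) (≡.trans (cong length e) (length-replicate m'))
word-injective zero    zero    (suc j') m' ()
word-injective zero    (suc m) (suc j') m' ()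
word-injective (suc j) m zero     zero     ()
word-injective (suc j) m zero     (suc m') ()
word-injective (suc j) m (suc j') m' e
  with refl , m≡m' ← word-injective j m j' m' (proj₂ (∷-injective e)) = refl , m≡m'

EqualBlocks : PromiseProblem 2
EqualBlocks = record
  { Acc      = λ x → ∃ λ m → x ≡ word m m
  ; Rej      = λ x → ∃₂ λ j m → j ≢ m × x ≡ word j m
  ; disjoint = λ { _ (m , refl) (j , m' , j≢m' , e) →
                   let m≡j , m≡m' = word-injective m m j m' e in j≢m' (≡.trans (≡.sym m≡j) m≡m') }
  }

EqualBlocksFamily : Family 2
EqualBlocksFamily _ = EqualBlocks

-- A one-counter automaton for equal blocks

_≟ₘ_ : DecidableEquality Move
left  ≟ₘ left  = yes refl
left  ≟ₘ stay  = no λ ()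
left  ≟ₘ right = no λ ()
stay  ≟ₘ left  = no λ ()
stay  ≟ₘ stay  = yes refl
stay  ≟ₘ right = no λ ()
right ≟ₘ left  = no λ ()
right ≟ₘ stay  = no λ ()
right ≟ₘ right = yes refl

_≟ₒ_ : DecidableEquality Op
inc ≟ₒ inc = yes refl
inc ≟ₒ dec = no λ ()
inc ≟ₒ nop = no λ ()
dec ≟ₒ inc = no λ ()
dec ≟ₒ dec = yes refl
dec ≟ₒ nop = no λ ()
nop ≟ₒ inc = no λ ()
nop ≟ₒ dec = no λ ()
nop ≟ₒ nop = yes refl

_≟ₜ_ : ∀ {q k} → DecidableEquality (Transition q k)
_≟ₜ_ = Product.≡-dec Finₚ._≟_ (Product.≡-dec _≟ₘ_ (Vec.≡-dec _≟ₒ_))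

pattern readA = zero
pattern readB = suc zero
pattern acc   = suc (suc zero)
pattern rej   = suc (suc (suc zero))

-- Count the a's up, then count down along the b's; the Bool is the zero-test.
transition : Fin 4 → Tape 2 → Bool → Transition 4 1
transition readA ⊳       _     = readA , right , nop ∷ []
transition readA (sym 𝑎) _     = readA , right , inc ∷ []
transition readA _       _     = readB , stay  , nop ∷ []
transition readB (sym 𝑏) false = readB , right , dec ∷ []
transition readB ⊲       true  = acc   , stay  , nop ∷ []
transition _     _       _     = rej   , stay  , nop ∷ []

cmStatus : Fin 4 → Status
cmStatus acc = accepting
cmStatus rej = rejecting
cmStatus _   = inner

CM : Machine 2 1 4
CM = record
  { init   = readA
  ; status = cmStatus
  ; δ      = λ { p a (z ∷ []) t → does (t ≟ₜ transition p a z) }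
  }

CM-deterministic : Deterministic CM
CM-deterministic p a (z ∷ []) t t' fires fires' = ≡.trans (prescribed fires) (≡.sym (prescribed fires'))
  where
  prescribed : ∀ {t} → does (t ≟ₜ transition p a z) ≡ true → t ≡ transition p a z
  prescribed {t} fires with t ≟ₜ transition p a z
  ... | yes t≡transition = t≡transition

cmStep : ∀ {x p i c a p' d ops i' c'} → cmStatus p ≡ inner → tapeAt x i ≡ a →
         transition p a (isZero c) ≡ (p' , d , ops) → move d i ≡ just i' → i' ≤ suc (length x) →
         applyOps ops (c ∷ []) ≡ just (c' ∷ []) → Step CM x (p , i , c ∷ []) (p' , i' , c' ∷ [])
cmStep running reads prescribed moved bound counter =
  step running (dec-true (_ ≟ₜ _) (≡.sym (≡.trans (cong (λ a → transition _ a _) reads) prescribed)))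
       moved bound counter

-- The cells i, i+1, … of ⊳x⊲ spell w⊲.
ReadsFrom : ∀ {s} → List (Fin s) → ℕ → List (Fin s) → Set
ReadsFrom x i w = ∀ t → tapeAt x (t + i) ≡ tapeAt w (suc t)

ReadsFrom-tail : ∀ {s} {x : List (Fin s)} {i a w} → ReadsFrom x i (a ∷ w) → ReadsFrom x (suc i) w
ReadsFrom-tail {x = x} {i} reads t = ≡.trans (cong (tapeAt x) (+-suc t i)) (reads (suc t))

tapeAt-sym⇒≤length : ∀ {s} (x : List (Fin s)) i {a} → tapeAt x i ≡ sym a → i ≤ length x
tapeAt-sym⇒≤length []      zero          ()
tapeAt-sym⇒≤length []      (suc i)       ()
tapeAt-sym⇒≤length (_ ∷ x) zero          ()
tapeAt-sym⇒≤length (_ ∷ x) (suc zero)    _  = s≤s z≤n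
tapeAt-sym⇒≤length (_ ∷ x) (suc (suc i)) e  = s≤s (tapeAt-sym⇒≤length x (suc i) e)

Compares : List (Fin 2) → Config 4 1 → ℕ → ℕ → Set
Compares x c n m =
  ∃ λ c' → Star (Step CM x) c c' × (n ≡ m → proj₁ c' ≡ acc) × (n ≢ m → proj₁ c' ≡ rej)

Compares-◅ : ∀ {x c c₁ n m} → Step CM x c c₁ → Compares x c₁ n m → Compares x c n m
Compares-◅ st (c' , run , same , different) = c' , st ◅ run , same , different

Compares-suc : ∀ {x c n m} → Compares x c n m → Compares x c (suc n) (suc m)
Compares-suc (c' , run , same , different) = c' , run , same ∘ suc-injective , different ∘ (_∘ cong suc)

compare-b : ∀ {x i} m c → ReadsFrom x i (replicate m 𝑏) → i ≤ suc (length x) →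
            Compares x (readB , i , c ∷ []) c m
compare-b zero zero reads i≤ =
  -, cmStep refl (reads 0) refl refl i≤ refl ◅ ε , (λ _ → refl) , (λ 0≢0 → ⊥-elim (0≢0 refl))
compare-b zero (suc c) reads i≤ =
  -, cmStep refl (reads 0) refl refl i≤ refl ◅ ε , (λ ()) , (λ _ → refl)
compare-b (suc m) zero reads i≤ =
  -, cmStep refl (reads 0) refl refl i≤ refl ◅ ε , (λ ()) , (λ _ → refl)
compare-b {x} {i} (suc m) (suc c) reads _ =
  Compares-◅ (cmStep refl (reads 0) refl refl i<1+|x| refl)
             (Compares-suc (compare-b m c (ReadsFrom-tail reads) i<1+|x|))
  where
  i<1+|x| : suc i ≤ suc (length x)
  i<1+|x| = s≤s (tapeAt-sym⇒≤length x i (reads 0))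

compare-a : ∀ {x i} k c m → ReadsFrom x i (replicate k 𝑎 ++ replicate m 𝑏) → i ≤ suc (length x) →
            Compares x (readA , i , c ∷ []) (k + c) m
compare-a zero c zero reads i≤ =
  Compares-◅ (cmStep refl (reads 0) refl refl i≤ refl) (compare-b zero c reads i≤)
compare-a zero c (suc m) reads i≤ =
  Compares-◅ (cmStep refl (reads 0) refl refl i≤ refl) (compare-b (suc m) c reads i≤)
compare-a {x} {i} (suc k) c m reads _ =
  Compares-◅ (cmStep refl (reads 0) refl refl i<1+|x| refl)
             (subst (λ n → Compares x (readA , suc i , suc c ∷ []) n m) (+-suc k c)
                    (compare-a k (suc c) m (ReadsFrom-tail reads) i<1+|x|))
  where
  i<1+|x| : suc i ≤ suc (length x)
  i<1+|x| = s≤s (tapeAt-sym⇒≤length x i (reads 0))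

compare-word : ∀ j m → Compares (word j m) (initConfig CM) j m
compare-word j m =
  Compares-◅ (cmStep refl refl refl refl (s≤s z≤n) refl)
             (subst (λ n → Compares (word j m) (readA , 1 , 0 ∷ []) n m) (+-identityʳ j)
                    (compare-a j 0 m (λ t → cong (tapeAt (word j m)) (+-comm t 1)) (s≤s z≤n)))

CM-solves : Solves CM EqualBlocks
CM-solves = accepts , rejects
  where
  accepts : ∀ x → Acc EqualBlocks x → ∃ (AccPath CM x)
  accepts _ (m , refl) with _ , run , same , _ ← compare-word m m =
    accRun⇒chain (run ▸▸ halt (cong cmStatus (same refl)))
  rejects : ∀ x → Rej EqualBlocks x → ∀ ρ → ¬ AccPath CM x ρ
  rejects _ (j , m , j≢m , refl) _ (ch , accepted) with _ , run , _ , different ← compare-word j m =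
    rejecting-rejects (cong cmStatus (different j≢m))
                      (accRun-after CM-deterministic run (chain⇒accRun ch accepted))

CM-mode : ∀ md → ModeCond md CM EqualBlocks
CM-mode det    = CM-deterministic
CM-mode unamb  = Deterministic⇒Unambiguous CM-deterministic EqualBlocks
CM-mode nondet = tt

module _ {s k q} {M : Machine s k q} {x : List (Fin s)} where

  configs : ∀ {c} → AccRun M x c → List (Config q k)
  configs (halt _)            = []
  configs (_▸_ {c' = c'} _ r) = c' ∷ configs r

  LoopFree : ∀ {c} → AccRun M x c → Set
  LoopFree r = Unique (configs r)

  _≟ᶜ_ : DecidableEquality (Config q k)
  _≟ᶜ_ = Product.≡-dec Finₚ._≟_ (Product.≡-dec ℕ._≟_ (Vec.≡-dec ℕ._≟_))

  resume-at : ∀ {c₀ c} (r : AccRun M x c₀) → LoopFree r → c ∈ configs r →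
              Σ (AccRun M x c) λ r' → c ∉ configs r' × LoopFree r'
  resume-at (_ ▸ r) (c∉r ∷ loopFree) (here refl) = r , All¬⇒¬Any c∉r , loopFree
  resume-at (_ ▸ r) (_ ∷ loopFree)   (there c∈r) = resume-at r loopFree c∈r

  remove-loops : ∀ {c} → AccRun M x c → Σ (AccRun M x c) LoopFree
  remove-loops (halt accepted) = halt accepted , []
  remove-loops (_▸_ {c' = c'} st r) with r₁ , loopFree₁ ← remove-loops r with any? (c' ≟ᶜ_) (configs r₁)
  ... | no  c'∉r₁ = st ▸ r₁ , ¬Any⇒All¬ _ c'∉r₁ ∷ loopFree₁
  ... | yes c'∈r₁ with r₂ , c'∉r₂ , loopFree₂ ← resume-at r₁ loopFree₁ c'∈r₁ =
    st ▸ r₂ , ¬Any⇒All¬ _ c'∉r₂ ∷ loopFree₂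

-- Crossing sequences

-- A direction is a Fin 2, so that crossings can be counted.
Dir : Set
Dir = Fin 2

pattern rightward = zero
pattern leftward  = suc zero

-- Boundary β lies between cells β and suc β.
departure arrival : Dir → ℕ → ℕ
departure rightward β = β
departure leftward  β = suc β
arrival   rightward β = suc β
arrival   leftward  β = β

data Passage (β i i' : ℕ) : Set where
  crossing   : ∀ d → i ≡ departure d β → i' ≡ arrival d β → Passage β i i'
  noCrossing : (∀ d → ¬ (i ≡ departure d β × i' ≡ arrival d β)) → Passage β i i'

passage : ∀ β i i' → Passage β i i'
passage β i i' with (i ≟ β) ×-dec (i' ≟ suc β) | (i ≟ suc β) ×-dec (i' ≟ β)
... | yes (e , e') | _            = crossing rightward e e'
... | no _         | yes (e , e') = crossing leftward e e'
... | no ¬right    | no ¬left     = noCrossing λ { rightward → ¬right ; leftward → ¬left }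

move-adjacent : ∀ d {i i'} → move d i ≡ just i' → i' ≤ suc i × i ≤ suc i'
move-adjacent left  {suc i} refl = m≤n⇒m≤1+n (n≤1+n i) , ≤-refl
move-adjacent stay  {i}     refl = n≤1+n i , n≤1+n i
move-adjacent right {i}     refl = ≤-refl , m≤n⇒m≤1+n (n≤1+n i)

move-shift : ∀ d j e {i'} → 1 ≤ j → move d (j + e) ≡ just i' →
             ∃ λ j' → i' ≡ j' + e × move d j ≡ just j'
move-shift left  (suc j) e _ refl = j , refl , refl
move-shift stay  j       e _ refl = j , refl , refl
move-shift right j       e _ refl = suc j , refl , refl

stays-left : ∀ {β i i'} → ¬ (i ≡ β × i' ≡ suc β) → i ≤ β → i' ≤ suc i → i' ≤ β
stays-left {β} {i} {i'} ¬crossing i≤β i'≤1+i with i' ≤? β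
... | yes i'≤β = i'≤β
... | no  i'≰β = ⊥-elim (¬crossing (≤-antisym i≤β (≤-pred (≤-trans (≰⇒> i'≰β) i'≤1+i)) ,
                                   ≤-antisym (≤-trans i'≤1+i (s≤s i≤β)) (≰⇒> i'≰β)))

stays-right : ∀ {β i i'} → ¬ (i ≡ suc β × i' ≡ β) → suc β ≤ i → i ≤ suc i' → suc β ≤ i'
stays-right {β} {i} {i'} ¬crossing β<i i≤1+i' with suc β ≤? i'
... | yes β<i' = β<i'
... | no  β≮i' = ⊥-elim (¬crossing (≤-antisym (≤-trans i≤1+i' (s≤s i'≤β)) β<i ,
                                   ≤-antisym i'≤β (≤-pred (≤-trans β<i i≤1+i'))))
  where
  i'≤β : i' ≤ β
  i'≤β = ≤-pred (≰⇒> β≮i')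

Crossing : ℕ → Set
Crossing q = Dir × Fin q

arrivalConfig : ∀ {q} → ℕ → Crossing q → Config q 0
arrivalConfig β (d , p) = p , arrival d β , []

recordCrossing : ∀ {q β i i'} → Passage β i i' → Fin q → List (Crossing q) → List (Crossing q)
recordCrossing (crossing d _ _) p cs = (d , p) ∷ cs
recordCrossing (noCrossing _)   p cs = cs

Unique-resp-⊆ : ∀ {A : Set} {xs ys : List A} → xs ⊆ ys → Unique ys → Unique xs
Unique-resp-⊆ []             []              = []
Unique-resp-⊆ (_ ∷ʳ xs⊆ys)   (_ ∷ unique)    = Unique-resp-⊆ xs⊆ys unique
Unique-resp-⊆ (refl ∷ xs⊆ys) (y∉ys ∷ unique) = All-resp-⊆ xs⊆ys y∉ys ∷ Unique-resp-⊆ xs⊆ys unique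

module _ {s q} {M : Machine s 0 q} {x : List (Fin s)} where

  crossings : ∀ {c} → ℕ → AccRun M x c → List (Crossing q)
  crossings β (halt _) = []
  crossings β (_▸_ {c = _ , i , _} {c' = p' , i' , _} _ r) =
    recordCrossing (passage β i i') p' (crossings β r)

  size : ∀ {c} → AccRun M x c → ℕ
  size (halt _) = 0
  size (_ ▸ r)  = suc (size r)

  mutual
    after-crossing : ∀ β {c} (r : AccRun M x c) {d p cs} → crossings β r ≡ (d , p) ∷ cs →
                     Σ (AccRun M x (p , arrival d β , [])) λ r' → crossings β r' ≡ cs × size r' < size r
    after-crossing β (_▸_ {c = _ , i , _} {c' = _ , i' , []} _ r) same
      with r' , same' , r'≤r ← after-crossing-at (passage β i i') r same = r' , same' , s≤s r'≤r

    after-crossing-at : ∀ {β i i' p'} (π : Passage β i i') (r : AccRun M x (p' , i' , [])) {d p cs} →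
                        recordCrossing π p' (crossings β r) ≡ (d , p) ∷ cs →
                        Σ (AccRun M x (p , arrival d β , [])) λ r' → crossings β r' ≡ cs × size r' ≤ size r
    after-crossing-at (crossing _ _ refl) r refl = r , refl , ≤-refl
    after-crossing-at (noCrossing _)      r same with r' , same' , r'<r ← after-crossing _ r same =
      r' , same' , <⇒≤ r'<r

  mutual
    crossings-⊆ : ∀ β {c} (r : AccRun M x c) → map (arrivalConfig β) (crossings β r) ⊆ configs r
    crossings-⊆ β (halt _) = []
    crossings-⊆ β (_▸_ {c = _ , i , _} {c' = _ , i' , []} _ r) = crossings-⊆-at (passage β i i') r

    crossings-⊆-at : ∀ {β i i' p'} (π : Passage β i i') (r : AccRun M x (p' , i' , [])) →
                     map (arrivalConfig β) (recordCrossing π p' (crossings β r)) ⊆ (p' , i' , []) ∷ configs r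
    crossings-⊆-at (crossing _ _ refl) r = refl ∷ crossings-⊆ _ r
    crossings-⊆-at (noCrossing _)      r = _ ∷ʳ crossings-⊆ _ r

  crossings-unique : ∀ β {c} (r : AccRun M x c) → LoopFree r → Unique (crossings β r)
  crossings-unique β r = Unique.map⁻ ∘ Unique-resp-⊆ (crossings-⊆ β r)

lookup-distinct : ∀ {A : Set} {l : List A} → Unique l → ∀ {i j} → i Fin.< j → lookup l i ≢ lookup l j
lookup-distinct (x∉l ∷ _)    {zero}  {suc j} _         = All.lookup x∉l (∈-lookup j)
lookup-distinct (_ ∷ unique) {suc i} {suc j} (s≤s i<j) = lookup-distinct unique i<j

Unique⇒length≤ : ∀ {K} {l : List (Fin K)} → Unique l → length l ≤ K
Unique⇒length≤ {l = l} unique = ≮⇒≥ λ K<length →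
  let i , j , i<j , same = Finₚ.pigeonhole K<length (lookup l) in lookup-distinct unique i<j same

-- Lists of length ≤ n over Fin K, padded with a blank to length n and read as numerals in base suc K.
encode : ∀ {K} n → List (Fin K) → Fin (suc K ^ n)
encode zero    _       = zero
encode {K} (suc n) []  = combine {suc K} zero (encode n [])
encode (suc n) (a ∷ l) = combine (suc a) (encode n l)

encode-injective : ∀ {K} n {l l' : List (Fin K)} → length l ≤ n → length l' ≤ n →
                   encode n l ≡ encode n l' → l ≡ l'
encode-injective zero    {[]}    {[]}      _         _          _    = refl
encode-injective (suc n) {[]}    {[]}      _         _          _    = refl
encode-injective (suc n) {[]}    {a' ∷ l'} _         _          same
  with () , _ ← Finₚ.combine-injective zero (encode n []) (suc a') (encode n l') same
encode-injective (suc n) {a ∷ l} {[]}      _         _          same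
  with () , _ ← Finₚ.combine-injective (suc a) (encode n l) zero (encode n []) same
encode-injective (suc n) {a ∷ l} {a' ∷ l'} (s≤s l≤n) (s≤s l'≤n) same
  with refl , same' ← Finₚ.combine-injective (suc a) (encode n l) (suc a') (encode n l') same =
  cong (a ∷_) (encode-injective n l≤n l'≤n same')

crossingIndex : ∀ {q} → Crossing q → Fin (2 * q)
crossingIndex (d , p) = combine d p

crossingIndex-injective : ∀ {q} {e e' : Crossing q} → crossingIndex e ≡ crossingIndex e' → e ≡ e'
crossingIndex-injective {e = d , p} {d' , p'} same
  with refl , refl ← Finₚ.combine-injective d p d' p' same = refl

crossings-collide : ∀ {s q} {M : Machine s 0 q} {x c} (r : AccRun M x c) → LoopFree r →
                    ∃₂ λ β₁ β₂ → β₁ < β₂ × β₂ ≤ suc (2 * q) ^ (2 * q) ×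
                                 crossings β₁ r ≡ crossings β₂ r
crossings-collide {q = q} r loopFree =
  let i , j , i<j , same = Finₚ.pigeonhole (n<1+n _) (code ∘ toℕ) in
  toℕ i , toℕ j , i<j , ≤-pred (Finₚ.toℕ<n j) ,
  map-injective crossingIndex-injective (encode-injective (2 * q) (short (toℕ i)) (short (toℕ j)) same)
  where
  code : ℕ → Fin (suc (2 * q) ^ (2 * q))
  code β = encode (2 * q) (map crossingIndex (crossings β r))

  short : ∀ β → length (map crossingIndex (crossings β r)) ≤ 2 * q
  short β = Unique⇒length≤ (Unique.map⁺ crossingIndex-injective (crossings-unique β r loopFree))

-- Cutting a run between two boundaries with equal crossing sequences

tapeAt-++ˡ : ∀ {s} (u w w' : List (Fin s)) {i} → i ≤ length u → tapeAt (u ++ w) i ≡ tapeAt (u ++ w') i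
tapeAt-++ˡ u       w w' {zero}        _         = refl
tapeAt-++ˡ (_ ∷ u) w w' {suc zero}    _         = refl
tapeAt-++ˡ (_ ∷ u) w w' {suc (suc i)} (s≤s i<u) = tapeAt-++ˡ u w w' i<u

tapeAt-++ʳ : ∀ {s} (u w : List (Fin s)) t → tapeAt (u ++ w) (suc (length u + t)) ≡ tapeAt w (suc t)
tapeAt-++ʳ []      w t = refl
tapeAt-++ʳ (_ ∷ u) w t = tapeAt-++ʳ u w t

module Cut {s q} (M : Machine s 0 q) (u v w : List (Fin s)) where

  x z : List (Fin s)
  x = u ++ v ++ w
  z = u ++ w

  β₁ d β₂ : ℕ
  β₁ = length u
  d  = length v
  β₂ = β₁ + d

  tape-left : ∀ {i} → i ≤ β₁ → tapeAt z i ≡ tapeAt x i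
  tape-left = tapeAt-++ˡ u w (v ++ w)

  tape-right : ∀ {i} → suc β₁ ≤ i → tapeAt z i ≡ tapeAt x (i + d)
  tape-right β₁<i with t , refl ← m≤n⇒∃[o]m+o≡n β₁<i = begin
    tapeAt z (suc (β₁ + t))             ≡⟨ tapeAt-++ʳ u w t ⟩
    tapeAt w (suc t)                    ≡⟨ tapeAt-++ʳ v w t ⟨
    tapeAt (v ++ w) (suc (d + t))       ≡⟨ tapeAt-++ʳ u (v ++ w) (d + t) ⟨
    tapeAt x (suc (β₁ + (d + t)))       ≡⟨ cong (λ n → tapeAt x (suc (β₁ + n))) (+-comm t d) ⟨
    tapeAt x (suc (β₁ + (t + d)))       ≡⟨ cong (tapeAt x ∘ suc) (+-assoc β₁ t d) ⟨
    tapeAt x (suc (β₁ + t + d))         ∎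
    where open ≡-Reasoning

  length-x : length x ≡ length z + d
  length-x = begin
    length (u ++ v ++ w)           ≡⟨ length-++ u ⟩
    β₁ + length (v ++ w)           ≡⟨ cong (β₁ +_) (≡.trans (length-++ v) (+-comm d (length w))) ⟩
    β₁ + (length w + d)            ≡⟨ +-assoc β₁ (length w) d ⟨
    β₁ + length w + d              ≡⟨ cong (_+ d) (length-++ u) ⟨
    length (u ++ w) + d            ∎
    where open ≡-Reasoning

  in-bounds-left : ∀ {i} → i ≤ β₁ → i ≤ suc (length z)
  in-bounds-left i≤β₁ = ≤-trans i≤β₁ (m≤n⇒m≤1+n (length-++-≤ˡ u))

  in-bounds-right : ∀ {j} → j + d ≤ suc (length x) → j ≤ suc (length z)
  in-bounds-right {j} bound =
    +-cancelʳ-≤ d j (suc (length z)) (subst (λ n → j + d ≤ suc n) length-x bound)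

  retape : ∀ {p a b t} → a ≡ b → δ M p b [] t ≡ true → δ M p a [] t ≡ true
  retape {p} {t = t} a≡b = subst (λ a → δ M p a [] t ≡ true) (≡.sym a≡b)

  -- left-phase follows the suffix P of the run on x while it stays left of β₁; when P crosses β₁
  -- rightwards, the equal crossing sequences let z continue with the suffix Q of the same run after the
  -- matching crossing of β₂, read d cells further left.  right-phase is symmetric.
  mutual
    left-phase : ∀ fuel {p i c} (P : AccRun M x (p , i , [])) (Q : AccRun M x c) → i ≤ β₁ →
                 crossings β₁ P ≡ crossings β₂ Q → size P + size Q < fuel → AccRun M z (p , i , [])
    left-phase zero       _               _ _    _    ()
    left-phase (suc _)    (halt accepted) _ _    _    _     = halt accepted
    left-phase (suc fuel) {i = i} (_▸_ {c' = _ , i' , []} st P) Q i≤β₁ same small =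
      left-phase-step fuel (passage β₁ i i') st P Q i≤β₁ same (≤-pred small)

    left-phase-step : ∀ fuel {p i p' i' c} (π : Passage β₁ i i') → Step M x (p , i , []) (p' , i' , []) →
                      (P : AccRun M x (p' , i' , [])) (Q : AccRun M x c) → i ≤ β₁ →
                      recordCrossing π p' (crossings β₁ P) ≡ crossings β₂ Q → size P + size Q < fuel →
                      AccRun M z (p , i , [])
    left-phase-step fuel (noCrossing ¬crossing) (step running fires moved _ counters) P Q i≤β₁ same small =
      step running (retape (tape-left i≤β₁) fires) moved (in-bounds-left i'≤β₁) counters
      ▸ left-phase fuel P Q i'≤β₁ same small
      where
      i'≤β₁ : _ ≤ β₁
      i'≤β₁ = stays-left (¬crossing rightward) i≤β₁ (proj₁ (move-adjacent _ moved))
    left-phase-step fuel (crossing leftward refl _) _ _ _ β₁<β₁ _ _ = ⊥-elim (1+n≰n β₁<β₁)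
    left-phase-step fuel (crossing rightward refl refl) (step running fires moved _ counters) P Q _ same small
      with Q' , same' , Q'<Q ← after-crossing β₂ Q (≡.sym same) =
      step running (retape (tape-left ≤-refl) fires) moved (s≤s (length-++-≤ˡ u)) counters
      ▸ right-phase fuel {j = suc β₁} Q' P ≤-refl (≡.sym same') (<-trans (+-monoʳ-< (size P) Q'<Q) small)

    right-phase : ∀ fuel {r j c} (Q : AccRun M x (r , j + d , [])) (P : AccRun M x c) → suc β₁ ≤ j →
                  crossings β₁ P ≡ crossings β₂ Q → size P + size Q < fuel → AccRun M z (r , j , [])
    right-phase zero       _               _ _    _    ()
    right-phase (suc _)    (halt accepted) _ _    _    _     = halt accepted
    right-phase (suc fuel) {j = j} (_▸_ {c' = _ , i' , []} st Q) P β₁<j same small =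
      right-phase-step fuel (passage β₂ (j + d) i') st Q P β₁<j same
                       (≤-pred (subst (_< suc fuel) (+-suc (size P) (size Q)) small))

    right-phase-step : ∀ fuel {r j r' i' c} (π : Passage β₂ (j + d) i') →
                       Step M x (r , j + d , []) (r' , i' , []) →
                       (Q : AccRun M x (r' , i' , [])) (P : AccRun M x c) → suc β₁ ≤ j →
                       crossings β₁ P ≡ recordCrossing π r' (crossings β₂ Q) → size P + size Q < fuel →
                       AccRun M z (r , j , [])
    right-phase-step fuel {j = j} (noCrossing ¬crossing) (step {d = dir} running fires moved bound counters)
                     Q P β₁<j same small
      with j' , refl , moved' ← move-shift dir j d (≤-trans (s≤s z≤n) β₁<j) moved =
      let β₁<j' = stays-right (λ (j≡ , j'≡) → ¬crossing leftward (cong (_+ d) j≡ , cong (_+ d) j'≡))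
                              β₁<j (proj₂ (move-adjacent dir moved'))
      in step running (retape (tape-right β₁<j) fires) moved' (in-bounds-right bound) counters
         ▸ right-phase fuel Q P β₁<j' same small
    right-phase-step fuel {j = j} (crossing rightward j+d≡β₂ _) _ _ _ β₁<j _ _ =
      ⊥-elim (1+n≰n (subst (suc β₁ ≤_) (+-cancelʳ-≡ d j β₁ j+d≡β₂) β₁<j))
    right-phase-step fuel {j = j} (crossing leftward _ refl) (step {d = dir} running fires moved _ counters)
                     Q P β₁<j same small
      with P' , same' , P'<P ← after-crossing β₁ P same
      with j' , β₂≡j'+d , moved' ← move-shift dir j d (≤-trans (s≤s z≤n) β₁<j) moved =
      step running (retape (tape-right β₁<j) fires)
           (subst (λ n → move dir j ≡ just n) (≡.sym (+-cancelʳ-≡ d β₁ j' β₂≡j'+d)) moved')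
           (in-bounds-left ≤-refl) counters
      ▸ left-phase fuel P' Q ≤-refl same' (<-trans (+-monoˡ-< (size Q) P'<P) small)

  cut : ∀ {p} (r : AccRun M x (p , 0 , [])) → crossings β₁ r ≡ crossings β₂ r → AccRun M z (p , 0 , [])
  cut r same = left-phase (suc (size r + size r)) r r z≤n same ≤-refl

cut-out : ∀ {s q} (M : Machine s 0 q) u v w {x} → x ≡ u ++ v ++ w →
          (r : AccRun M x (init M , 0 , [])) → crossings (length u) r ≡ crossings (length u + length v) r →
          AccRun M (u ++ w) (init M , 0 , [])
cut-out M u v w refl = Cut.cut M u v w

-- Equal blocks are beyond 2nfa's

cut-a-block : ∀ {q} (M : Machine 2 0 q) {n m b₁ b₂} → b₁ ≤ b₂ → b₂ ≤ n →
              (r : AccRun M (word n m) (init M , 0 , [])) → crossings b₁ r ≡ crossings b₂ r →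
              AccRun M (word (b₁ + (n ∸ b₂)) m) (init M , 0 , [])
cut-a-block M {n} {m} {b₁} {b₂} b₁≤b₂ b₂≤n r same =
  subst (λ y → AccRun M y _) (≡.sym (replicate-+-++ b₁ (n ∸ b₂) bs))
        (cut-out M as₁ as₂ (replicate (n ∸ b₂) 𝑎 ++ bs) split r
             (subst₂ (λ β₁ β₂ → crossings β₁ r ≡ crossings β₂ r)
                     (≡.sym |as₁|) (≡.sym |as₁as₂|) same))
  where
  bs as₁ as₂ : List (Fin 2)
  bs  = replicate m 𝑏
  as₁ = replicate b₁ 𝑎
  as₂ = replicate (b₂ ∸ b₁) 𝑎

  |as₁| : length as₁ ≡ b₁
  |as₁| = length-replicate b₁

  |as₁as₂| : length as₁ + length as₂ ≡ b₂
  |as₁as₂| = ≡.trans (cong₂ _+_ |as₁| (length-replicate (b₂ ∸ b₁))) (m+[n∸m]≡n b₁≤b₂)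

  n-split : b₁ + ((b₂ ∸ b₁) + (n ∸ b₂)) ≡ n
  n-split = begin
    b₁ + ((b₂ ∸ b₁) + (n ∸ b₂)) ≡⟨ +-assoc b₁ (b₂ ∸ b₁) (n ∸ b₂) ⟨
    b₁ + (b₂ ∸ b₁) + (n ∸ b₂)   ≡⟨ cong (_+ (n ∸ b₂)) (m+[n∸m]≡n b₁≤b₂) ⟩
    b₂ + (n ∸ b₂)               ≡⟨ m+[n∸m]≡n b₂≤n ⟩
    n                           ∎
    where open ≡-Reasoning

  split : word n m ≡ as₁ ++ as₂ ++ replicate (n ∸ b₂) 𝑎 ++ bs
  split = begin
    replicate n 𝑎 ++ bs                             ≡⟨ cong (λ k → replicate k 𝑎 ++ bs) n-split ⟨
    replicate (b₁ + ((b₂ ∸ b₁) + (n ∸ b₂))) 𝑎 ++ bs ≡⟨ replicate-+-++ b₁ _ bs ⟩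
    as₁ ++ replicate ((b₂ ∸ b₁) + (n ∸ b₂)) 𝑎 ++ bs ≡⟨ cong (as₁ ++_) (replicate-+-++ (b₂ ∸ b₁) _ bs) ⟩
    as₁ ++ as₂ ++ replicate (n ∸ b₂) 𝑎 ++ bs        ∎
    where open ≡-Reasoning

cut-a-block-shorter : ∀ {n b₁ b₂} → b₁ < b₂ → b₂ ≤ n → b₁ + (n ∸ b₂) < n
cut-a-block-shorter {n} {b₁} {b₂} b₁<b₂ b₂≤n =
  <-≤-trans (+-monoˡ-< (n ∸ b₂) b₁<b₂) (≤-reflexive (m+[n∸m]≡n b₂≤n))

EqualBlocks-unsolvable : ∀ {q} (M : Machine 2 0 q) → ¬ Solves M EqualBlocks
EqualBlocks-unsolvable {q} M (accepts , rejects) =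
  let r , loopFree = remove-loops (uncurry chain⇒accRun (proj₂ (accepts (word N N) (N , refl))))
      b₁ , b₂ , b₁<b₂ , b₂≤N , same = crossings-collide r loopFree
  in uncurry (rejects _ (b₁ + (N ∸ b₂) , N , <⇒≢ (cut-a-block-shorter b₁<b₂ b₂≤N) , refl))
             (accRun⇒chain (cut-a-block M (<⇒≤ b₁<b₂) b₂≤N r same))
  where
  N : ℕ
  N = suc (2 * q) ^ (2 * q)

EqualBlocks∉Class₀ : ∀ md → ¬ Class md 0 2 EqualBlocksFamily
EqualBlocks∉Class₀ md (_ , _ , M , _ , solves) = EqualBlocks-unsolvable (M 0) (proj₁ (solves 0))

EqualBlocks∈Class₁ : ∀ md → Class md 1 2 EqualBlocksFamily
EqualBlocks∈Class₁ md =
  4 ∷ [] , (λ _ → 4) , (λ _ → CM) , (λ n → m≤m+n 4 (n * 0)) , λ _ → CM-solves , CM-mode md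

one-counter-helps : ∀ md → ¬ (Class md 0 ≐ Class md 1)
one-counter-helps md same =
  EqualBlocks∉Class₀ md (proj₂ (same 2 EqualBlocksFamily) (EqualBlocks∈Class₁ md))

lemma3p1 : (¬ (2D ≐ 2DCT)) × (¬ (2U ≐ 2UCT)) × (¬ (2N ≐ 2NCT))
lemma3p1 = one-counter-helps det , one-counter-helps unamb , one-counter-helps nondet
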